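{- For every base $\mathcal{B}$, atomic multisets $L,K$ and formulae $\varphi,\psi,\chi$: if $\Vdash^{L}_{\mathcal{B}}\varphi\oplus\psi$, $\varphi\Vdash^{K}_{\mathcal{B}}\chi$ and $\psi\Vdash^{K}_{\mathcal{B}}\chi$, then $\Vdash^{L\uplus K}_{\mathcal{B}}\chi$.
   Context: Fix a set $\mathbb{A}$ of propositional atoms. All multisets are finite; $\uplus$ denotes multiset union; an atomic multiset is a finite multiset of atoms. Formulae: $\varphi ::= p\in\mathbb{A}\mid\top\mid 0\mid 1\mid\varphi\multimap\varphi\mid\varphi\otimes\varphi\mid\varphi\mathbin{\&}\varphi\mid\varphi\oplus\varphi\mid\,!\varphi$. Bases. An atomic sequent is a pair $P\Rightarrow p$ ($P$ atomic multiset, $p$ atom); an atomic box is a finite multiset of atomic sequents; an atomic rule is a triple $\langle\mathbf{A},\mathbf{S},p\rangle$ with $\mathbf{A}$ a finite multiset of atomic boxes, $\mathbf{S}$ an atomic box, $p$ an atom. A base is a set of atomic rules; $\mathcal{C}\supseteq\mathcal{B}$ is set inclusion. An atom $p$ is persistent in $\mathcal{B}$ if $\mathcal{B}$ contains a rule $\langle\varnothing,\mathbf{S},p\rangle$ with $\mathbf{S}\neq\varnothing$. Derivability $P\vdash_{\mathcal{B}}p$ is the smallest relation closed under: (Ref) $\{p\}\vdash_{\mathcal{B}}p$; (App) if $\langle\mathbf{A},\mathbf{S},p\rangle\in\mathcal{B}$ with $\mathbf{A}=\{\mathbf{T}_1,\dots,\mathbf{T}_m\}$, and there are $n\ge m$,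 atomic multisets $C_1,\dots,C_n$ and a multiset $D=\{d_{m+1},\dots,d_n\}$ of atoms persistent in $\mathcal{B}$ with $C_i\uplus Q\vdash_{\mathcal{B}}q$ for all $i\le m$ and $Q\Rightarrow q\in\mathbf{T}_i$, $C_j\vdash_{\mathcal{B}}d_j$ for all $m<j\le n$, and $D\uplus U\vdash_{\mathcal{B}}v$ for all $U\Rightarrow v\in\mathbf{S}$, then $C_1\uplus\dots\uplus C_n\vdash_{\mathcal{B}}p$. Support. For a base $\mathcal{B}$, atomic multiset $L$: (At) $\Vdash^L_{\mathcal{B}}p$ iff $L\vdash_{\mathcal{B}}p$; ($\multimap$) $\Vdash^L_{\mathcal{B}}\varphi\multimap\psi$ iff $\varphi\Vdash^L_{\mathcal{B}}\psi$; ($\otimes$) $\Vdash^L_{\mathcal{B}}\varphi\otimes\psi$ iff for all $\mathcal{C}\supseteq\mathcal{B}$, atomic multisets $K$, atoms $p$: if $\{\varphi,\psi\}\Vdash^K_{\mathcal{C}}p$ then $\Vdash^{L\uplus K}_{\mathcal{C}}p$; ($1$) $\Vdash^L_{\mathcal{B}}1$ iff for all $\mathcal{C}\supseteq\mathcal{B}$, $K$, $p$: if $\Vdash^K_{\mathcal{C}}p$ then $\Vdash^{L\uplus K}_{\mathcal{C}}p$; ($\mathbin{\&}$) $\Vdash^L_{\mathcal{B}}\varphi\mathbin{\&}\psi$ iff $\Vdash^L_{\mathcal{B}}\varphi$ and $\Vdash^L_{\mathcal{B}}\psi$; ($\oplus$) $\Vdash^L_{\mathcal{B}}\varphi\oplus\psi$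 iff for all $\mathcal{C}\supseteq\mathcal{B}$, $K$, $p$: if $\varphi\Vdash^K_{\mathcal{C}}p$ and $\psi\Vdash^K_{\mathcal{C}}p$ then $\Vdash^{L\uplus K}_{\mathcal{C}}p$; ($0$) $\Vdash^L_{\mathcal{B}}0$ iff $\Vdash^{L\uplus K}_{\mathcal{B}}p$ for all atoms $p$ and atomic multisets $K$; ($\top$) $\Vdash^L_{\mathcal{B}}\top$ always; ($!$) $\Vdash^L_{\mathcal{B}}\,!\varphi$ iff for all $\mathcal{C}\supseteq\mathcal{B}$, $K$, $p$: if (for all $\mathcal{D}\supseteq\mathcal{C}$, $\Vdash^{\varnothing}_{\mathcal{D}}\varphi$ implies $\Vdash^K_{\mathcal{D}}p$) then $\Vdash^{L\uplus K}_{\mathcal{C}}p$. Multisets: $\Vdash^L_{\mathcal{B}}\varnothing$ iff $L=\varnothing$; $\Vdash^L_{\mathcal{B}}\{\varphi\}$ iff $\Vdash^L_{\mathcal{B}}\varphi$; $\Vdash^L_{\mathcal{B}}\Gamma\uplus\Delta$ iff $L=K\uplus M$ for some $K,M$ with $\Vdash^K_{\mathcal{B}}\Gamma$, $\Vdash^M_{\mathcal{B}}\Delta$. (Inf) For non-empty $\Gamma$, write $\Gamma=\,!\Delta\uplus\Theta$ with $!\Delta$ the elements whose top-level connective is $!$ and $\Theta$ the rest; $\Gamma\Vdash^L_{\mathcal{B}}\varphi$ iff for all $\mathcal{C}\supseteq\mathcal{B}$ and atomic $K$: if $\Vdash^{\varnothing}_{\mathcal{C}}\delta$ for every $\delta\in\Delta$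 and $\Vdash^K_{\mathcal{C}}\Theta$, then $\Vdash^{L\uplus K}_{\mathcal{C}}\varphi$. For $\Gamma=\varnothing$, $\Gamma\Vdash^L_{\mathcal{B}}\varphi$ means $\Vdash^L_{\mathcal{B}}\varphi$. -}

module Defs where

open import Level using (Level) renaming (suc to lsuc; zero to lzero)
open import Data.List using (List; []; _∷_; [_]; _++_; concat; map)
open import Data.List.Membership.Propositional using (_∈_)
open import Data.List.Relation.Unary.All using (All)
open import Data.List.Relation.Binary.Pointwise using (Pointwise)
open import Data.List.Relation.Binary.Permutation.Propositional using (_↭_)
open import Data.Product using (Σ; ∃; _×_; _,_; proj₁; proj₂)
open import Relation.Binary.PropositionalEquality using (_≢_)

-- Finite multisets are represented by lists,
-- considered up to permutation (_↭_); multiset union ⊎ is _++_.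
module Semantics {Atom : Set} where

  infixr 5 _⊸_
  infixr 6 _⊕_
  infixr 7 _⊗_ _&_
  data Formula : Set where
    atom : Atom → Formula
    ⊤    : Formula
    𝟘    : Formula
    𝟙    : Formula
    _⊸_  : Formula → Formula → Formula
    _⊗_  : Formula → Formula → Formula
    _&_  : Formula → Formula → Formula
    _⊕_  : Formula → Formula → Formula
    !_   : Formula → Formula

  AtomicMultiset : Set
  AtomicMultiset = List Atom

  AtomicSequent : Set
  AtomicSequent = AtomicMultiset × Atom

  Box : Set
  Box = List AtomicSequent

  record Rule : Set where
    constructor rule
    field
      premises : List Box
      sideBox  : Box
      concl    : Atom

  Base : Set₁
  Base = Rule → Set

  _⊇_ : Base → Base → Set
  C ⊇ B = ∀ r → B r → C r

  Persistent : Base → Atom → Set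
  Persistent B p = Σ Box λ S → (S ≢ []) × B (rule [] S p)

  -- Derivability P ⊢_B p (closed under permutation of P by construction)
  data Deriv (B : Base) : AtomicMultiset → Atom → Set where
    ref : ∀ {L p} → L ↭ [ p ] → Deriv B L p
    app : ∀ {L} (A : List Box) (S : Box) (p : Atom) → B (rule A S p) →
          -- C₁ … Cₘ, one for each box Tᵢ of A
          (Cs : List AtomicMultiset) →
          Pointwise (λ C T → ∀ {Q q} → (Q , q) ∈ T → Deriv B (C ++ Q) q) Cs A →
          -- pairs (Cⱼ , dⱼ) for m < j ≤ n, with dⱼ persistent and Cⱼ ⊢ dⱼ
          (Ds : List (AtomicMultiset × Atom)) →
          All (λ cd → Persistent B (proj₂ cd) × Deriv B (proj₁ cd) (proj₂ cd)) Ds →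
          -- D ⊎ U ⊢ v for all U ⇒ v ∈ S, where D = {d_{m+1},…,d_n}
          (∀ {U v} → (U , v) ∈ S → Deriv B (map proj₂ Ds ++ U) v) →
          L ↭ concat Cs ++ concat (map proj₁ Ds) →
          Deriv B L p

  -- Semantic hypotheses: an element of a context, either of the form !δ
  -- (recorded by "⊩^∅_C δ") or not (recorded by "⊩^K_C θ").
  data Hyp : Set₂ where
    bangH  : (Base → Set₁) → Hyp
    plainH : (Base → AtomicMultiset → Set₁) → Hyp

  BangsHold : Base → List Hyp → Set₁
  BangsHold C []               = Level.Lift (lsuc lzero) Data.Unit.⊤
    where import Data.Unit
  BangsHold C (bangH P  ∷ hs)  = P C × BangsHold C hs
  BangsHold C (plainH _ ∷ hs)  = BangsHold C hs

  PlainHold : Base → AtomicMultiset → List Hyp → Set₁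
  PlainHold C K []              = Level.Lift (lsuc lzero) (K ↭ [])
  PlainHold C K (bangH _  ∷ hs) = PlainHold C K hs
  PlainHold C K (plainH Q ∷ hs) =
    Σ AtomicMultiset λ K₁ → Σ AtomicMultiset λ K₂ →
      Level.Lift (lsuc lzero) (K ↭ K₁ ++ K₂) × Q C K₁ × PlainHold C K₂ hs

  -- (Inf) for a non-empty context, with conclusion given semantically
  InfSem : Base → List Hyp → AtomicMultiset → (Base → AtomicMultiset → Set₁) → Set₁
  InfSem B hs L concl =
    ∀ (C : Base) → C ⊇ B → ∀ (K : AtomicMultiset) →
      BangsHold C hs → PlainHold C K hs → concl C (L ++ K)

  Supp : Base → AtomicMultiset → Formula → Set₁
  hyp  : Formula → Hyp

  hyp (! δ) = bangH (λ C → Supp C [] δ)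
  hyp φ     = plainH (λ C K → Supp C K φ)

  Supp B L (atom p) = Level.Lift (lsuc lzero) (Deriv B L p)
  Supp B L (φ ⊸ ψ)  = InfSem B (hyp φ ∷ []) L (λ C M → Supp C M ψ)
  Supp B L (φ ⊗ ψ)  =
    ∀ (C : Base) → C ⊇ B → ∀ (K : AtomicMultiset) (p : Atom) →
      InfSem C (hyp φ ∷ hyp ψ ∷ []) K (λ D M → Level.Lift (lsuc lzero) (Deriv D M p)) →
      Deriv C (L ++ K) p
  Supp B L 𝟙 =
    ∀ (C : Base) → C ⊇ B → ∀ (K : AtomicMultiset) (p : Atom) →
      Deriv C K p → Deriv C (L ++ K) p
  Supp B L (φ & ψ)  = Supp B L φ × Supp B L ψ
  Supp B L (φ ⊕ ψ)  =
    ∀ (C : Base) → C ⊇ B → ∀ (K : AtomicMultiset) (p : Atom) →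
      InfSem C (hyp φ ∷ []) K (λ D M → Level.Lift (lsuc lzero) (Deriv D M p)) →
      InfSem C (hyp ψ ∷ []) K (λ D M → Level.Lift (lsuc lzero) (Deriv D M p)) →
      Deriv C (L ++ K) p
  Supp B L 𝟘 =
    Level.Lift (lsuc lzero) (∀ (p : Atom) (K : AtomicMultiset) → Deriv B (L ++ K) p)
  Supp B L ⊤ = Level.Lift (lsuc lzero) Data.Unit.⊤
    where import Data.Unit
  Supp B L (! φ) =
    ∀ (C : Base) → C ⊇ B → ∀ (K : AtomicMultiset) (p : Atom) →
      (∀ (D : Base) → D ⊇ C → Supp D [] φ → Deriv D K p) →
      Deriv C (L ++ K) p

  SuppCtx : Base → List Formula → AtomicMultiset → Formula → Set₁
  SuppCtx B []         L φ = Supp B L φ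
  SuppCtx B Γ@(_ ∷ _)  L φ = InfSem B (map hyp Γ) L (λ C M → Supp C M φ)

open Semantics public

{-# OPTIONS --safe #-}
-- Call L eliminable for χ when, for every extension C of the base and every atomic
-- continuation at C (a context K and atom p such that M ⊎ K ⊢ p whenever M supports χ
-- in an extension of C), we have L ⊎ K ⊢_C p.  By induction on χ, eliminable contexts
-- support χ; the ⊸ case needs monotonicity of support to move its hypothesis up to the
-- extension where the continuation is used.  The ⊕-clause makes L ⊎ K eliminable for χ:
-- the continuation is fed through the two case hypotheses φ ⊩^K χ and ψ ⊩^K χ.
module Submission where

open import Defs
open import Data.List using (List; []; _∷_; _++_)
open import Data.List.Membership.Propositional using (_∈_)
open import Data.List.Relation.Binary.Pointwise using (Pointwise; []; _∷_)
open import Data.List.Relation.Binary.Permutation.Propositional using (_↭_; ↭-sym; ↭-trans)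
open import Data.List.Relation.Binary.Permutation.Propositional.Properties
  using (++⁺ˡ; ++-comm; ++-assoc; ++-identityʳ)
open import Data.List.Relation.Unary.All using (All; []; _∷_)
open import Data.Product using (_×_; _,_; proj₁; proj₂)
open import Data.Unit using (tt)
open import Level using (Lift; lift)

module _ {Atom : Set} where

  private variable
    B C D : Base {Atom}
    L M K : List Atom
    p : Atom

  ⊇-refl : B ⊇ B
  ⊇-refl r r∈B = r∈B

  ⊇-trans : D ⊇ C → C ⊇ B → D ⊇ B
  ⊇-trans D⊇C C⊇B r r∈B = D⊇C r (C⊇B r r∈B)

  deriv-↭ : Deriv B L p → L ↭ M → Deriv B M p
  deriv-↭ (ref L↭p) L↭M = ref (↭-trans (↭-sym L↭M) L↭p)
  deriv-↭ (app A S p r Cs boxes Ds persists side L↭CD) L↭M =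
    app A S p r Cs boxes Ds persists side (↭-trans (↭-sym L↭M) L↭CD)

  persistent-mono : C ⊇ B → Persistent B p → Persistent C p
  persistent-mono C⊇B (S , S≢[] , r∈B) = S , S≢[] , C⊇B _ r∈B

  mutual
    deriv-mono : C ⊇ B → Deriv B L p → Deriv C L p
    deriv-mono C⊇B (ref L↭p) = ref L↭p
    deriv-mono C⊇B (app A S p r Cs boxes Ds persists side L↭CD) =
      app A S p (C⊇B _ r) Cs (boxes-mono C⊇B boxes) Ds (persists-mono C⊇B persists)
          (λ U⇒v∈S → deriv-mono C⊇B (side U⇒v∈S)) L↭CD

    boxes-mono : ∀ {Cs As} → C ⊇ B →
      Pointwise (λ C′ T → ∀ {Q q} → (Q , q) ∈ T → Deriv B (C′ ++ Q) q) Cs As →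
      Pointwise (λ C′ T → ∀ {Q q} → (Q , q) ∈ T → Deriv C (C′ ++ Q) q) Cs As
    boxes-mono C⊇B [] = []
    boxes-mono C⊇B (box ∷ boxes) =
      (λ Q⇒q∈T → deriv-mono C⊇B (box Q⇒q∈T)) ∷ boxes-mono C⊇B boxes

    persists-mono : ∀ {Ds} → C ⊇ B →
      All (λ cd → Persistent B (proj₂ cd) × Deriv B (proj₁ cd) (proj₂ cd)) Ds →
      All (λ cd → Persistent C (proj₂ cd) × Deriv C (proj₁ cd) (proj₂ cd)) Ds
    persists-mono C⊇B [] = []
    persists-mono C⊇B ((pers , d) ∷ persists) =
      (persistent-mono C⊇B pers , deriv-mono C⊇B d) ∷ persists-mono C⊇B persists

  supp-mono : ∀ χ → C ⊇ B → Supp B L χ → Supp C L χ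
  supp-mono (atom a) C⊇B (lift d) = lift (deriv-mono C⊇B d)
  supp-mono ⊤       C⊇B s        = s
  supp-mono 𝟘       C⊇B (lift s) = lift λ p K → deriv-mono C⊇B (s p K)
  supp-mono 𝟙       C⊇B s        = λ D D⊇C → s D (⊇-trans D⊇C C⊇B)
  supp-mono (α ⊸ β) C⊇B s        = λ D D⊇C → s D (⊇-trans D⊇C C⊇B)
  supp-mono (α ⊗ β) C⊇B s        = λ D D⊇C → s D (⊇-trans D⊇C C⊇B)
  supp-mono (α & β) C⊇B (s , t)  = supp-mono α C⊇B s , supp-mono β C⊇B t
  supp-mono (α ⊕ β) C⊇B s        = λ D D⊇C → s D (⊇-trans D⊇C C⊇B)
  supp-mono (! α)   C⊇B s        = λ D D⊇C → s D (⊇-trans D⊇C C⊇B)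

  plainHold-mono : ∀ χ → C ⊇ B →
    PlainHold B K (plainH (λ D M → Supp D M χ) ∷ []) →
    PlainHold C K (plainH (λ D M → Supp D M χ) ∷ [])
  plainHold-mono χ C⊇B (K₁ , K₂ , K↭ , s , rest) = K₁ , K₂ , K↭ , supp-mono χ C⊇B s , rest

  hyp-mono : ∀ α → C ⊇ B →
    BangsHold B (hyp α ∷ []) → PlainHold B K (hyp α ∷ []) →
    BangsHold C (hyp α ∷ []) × PlainHold C K (hyp α ∷ [])
  hyp-mono (! δ)    C⊇B (s , none) ph = (supp-mono δ C⊇B s , none) , ph
  hyp-mono (atom a) C⊇B bh ph = bh , plainHold-mono (atom a) C⊇B ph
  hyp-mono ⊤        C⊇B bh ph = bh , plainHold-mono ⊤ C⊇B ph
  hyp-mono 𝟘        C⊇B bh ph = bh , plainHold-mono 𝟘 C⊇B ph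
  hyp-mono 𝟙        C⊇B bh ph = bh , plainHold-mono 𝟙 C⊇B ph
  hyp-mono (α ⊸ β)  C⊇B bh ph = bh , plainHold-mono (α ⊸ β) C⊇B ph
  hyp-mono (α ⊗ β)  C⊇B bh ph = bh , plainHold-mono (α ⊗ β) C⊇B ph
  hyp-mono (α & β)  C⊇B bh ph = bh , plainHold-mono (α & β) C⊇B ph
  hyp-mono (α ⊕ β)  C⊇B bh ph = bh , plainHold-mono (α ⊕ β) C⊇B ph

  Continuation : Base → Formula → List Atom → Atom → Set₁
  Continuation C χ K p = ∀ D → D ⊇ C → ∀ M → Supp D M χ → Deriv D (M ++ K) p

  Eliminable : Base → List Atom → Formula → Set₁
  Eliminable B L χ = ∀ C → C ⊇ B → ∀ K p → Continuation C χ K p → Deriv C (L ++ K) p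

  eliminable⇒supp : ∀ χ → Eliminable B L χ → Supp B L χ
  eliminable⇒supp {B} (atom p) el =
    lift (deriv-↭ (el B ⊇-refl [] p λ _ _ M (lift d) → deriv-↭ d (↭-sym (++-identityʳ M)))
                  (++-identityʳ _))
  eliminable⇒supp ⊤ el = lift tt
  eliminable⇒supp {B} 𝟘 el = lift λ p K → el B ⊇-refl K p λ _ _ _ (lift s) → s p K
  eliminable⇒supp 𝟙 el C C⊇B K p d =
    el C C⊇B K p λ D D⊇C _ s → s D ⊇-refl K p (deriv-mono D⊇C d)
  eliminable⇒supp (α ⊗ β) el C C⊇B K p k =
    el C C⊇B K p λ D D⊇C _ s → s D ⊇-refl K p λ E E⊇D → k E (⊇-trans E⊇D D⊇C)
  eliminable⇒supp (α ⊕ β) el C C⊇B K p k₁ k₂ =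
    el C C⊇B K p λ D D⊇C _ s →
      s D ⊇-refl K p (λ E E⊇D → k₁ E (⊇-trans E⊇D D⊇C)) (λ E E⊇D → k₂ E (⊇-trans E⊇D D⊇C))
  eliminable⇒supp (! α) el C C⊇B K p k =
    el C C⊇B K p λ D D⊇C _ s → s D ⊇-refl K p λ E E⊇D → k E (⊇-trans E⊇D D⊇C)
  eliminable⇒supp (α & β) el =
    eliminable⇒supp α (λ C C⊇B K p k → el C C⊇B K p λ D D⊇C M s → k D D⊇C M (proj₁ s)) ,
    eliminable⇒supp β (λ C C⊇B K p k → el C C⊇B K p λ D D⊇C M s → k D D⊇C M (proj₂ s))
  eliminable⇒supp {L = L} (α ⊸ β) el C C⊇B K bh ph =
    eliminable⇒supp β λ C′ C′⊇C K′ p k →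
      deriv-↭ (el C′ (⊇-trans C′⊇C C⊇B) (K ++ K′) p (apply-to-α C′⊇C k))
              (↭-sym (++-assoc L K K′))
    where
    apply-to-α : ∀ {C′ K′ p} → C′ ⊇ C → Continuation C′ β K′ p →
                 Continuation C′ (α ⊸ β) (K ++ K′) p
    apply-to-α C′⊇C k D D⊇C′ M s =
      let bh′ , ph′ = hyp-mono α (⊇-trans D⊇C′ C′⊇C) bh ph
      in deriv-↭ (k D D⊇C′ (M ++ K) (s D ⊇-refl K bh′ ph′)) (++-assoc M K _)

  ⊕-eliminable : ∀ {φ ψ χ} → Supp B L (φ ⊕ ψ) →
    SuppCtx B (φ ∷ []) K χ → SuppCtx B (ψ ∷ []) K χ → Eliminable B (L ++ K) χ
  ⊕-eliminable {B} {L} {K} {φ} {ψ} {χ} s h₁ h₂ C C⊇B K′ p k =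
    deriv-↭ (s C C⊇B (K ++ K′) p (feed φ h₁) (feed ψ h₂)) (↭-sym (++-assoc L K K′))
    where
    feed : ∀ θ → SuppCtx B (θ ∷ []) K χ →
           InfSem C (hyp θ ∷ []) (K ++ K′) (λ D M → Lift _ (Deriv D M p))
    feed _ h D D⊇C K″ bh ph =
      lift (deriv-↭ (k D D⊇C (K ++ K″) (h D (⊇-trans D⊇C C⊇B) K″ bh ph))
                    (↭-trans (++-assoc K K″ K′)
                      (↭-trans (++⁺ˡ K (++-comm K″ K′)) (↭-sym (++-assoc K K′ K″)))))

mainTheorem11 : {Atom : Set} (B : Base {Atom}) (L K : List Atom) (φ ψ χ : Formula {Atom}) →
    Supp B L (φ ⊕ ψ) →
    SuppCtx B (φ ∷ []) K χ →
    SuppCtx B (ψ ∷ []) K χ →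
    Supp B (L ++ K) χ
mainTheorem11 B L K φ ψ χ s h₁ h₂ = eliminable⇒supp χ (⊕-eliminable {φ = φ} {ψ} s h₁ h₂)
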